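{- For all $\lambda$-terms $M, N$: if $M \twoheadrightarrow_\beta N$, then $M$ and $N$ have the same Böhm tree and $\mathrm{CBT}(M) \geq \mathrm{CBT}(N)$, i.e., at every position of the clocked Böhm trees either neither tree carries an annotation, or both do and the annotation of $\mathrm{CBT}(M)$ is $\geq$ that of $\mathrm{CBT}(N)$. (Clocks are accelerated under reduction.)
   Context: Untyped $\lambda$-calculus. A head reduction step is a step $\lambda x_1\ldots x_n.(\lambda y.M)N N_1\ldots N_m \to \lambda x_1\ldots x_n.M[y:=N]N_1\ldots N_m$ ($n,m\geq 0$); a head normal form (hnf) is a term $\lambda x_1\ldots x_n.\,y N_1\ldots N_m$; a term has a hnf if it reduces to one. The clocked Böhm tree $\mathrm{CBT}(t)$ is the (possibly infinite) annotated term defined corecursively: if $t$ has no hnf, $\mathrm{CBT}(t)=\bot$ (unannotated); otherwise the head reduction of $t$ reaches a hnf $\lambda x_1\ldots x_n.\,y M_1\ldots M_m$ in exactly $k$ head steps, and $\mathrm{CBT}(t)$ is $\lambda x_1\ldots x_n.\,y\,\mathrm{CBT}(M_1)\ldots\mathrm{CBT}(M_m)$ with its root annotated by the natural number $k$. The Böhm tree $\mathrm{BT}(t)$ is $\mathrm{CBT}(t)$ with all annotations removed. Positions are sequences over $\{0,1,2\}$ (0: body of an abstraction, 1: function part, 2: argument part of an application), and the annotation at a position is the annotation of the root of the subtree there. -}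

module Defs where

open import Data.Nat using (ℕ; zero; suc; _≤_)
open import Data.Maybe using (Maybe; just; nothing)
open import Data.List using (List; []; _∷_)
open import Data.Product using (Σ; ∃; _×_; _,_)
open import Relation.Nullary using (¬_)
open import Relation.Binary.Construct.Closure.ReflexiveTransitive using (Star)

-- Untyped λ-terms (de Bruijn indices; α-equivalence is syntactic equality)

data Term : Set where
  var : ℕ → Term
  lam : Term → Term
  app : Term → Term → Term

ext : (ℕ → ℕ) → ℕ → ℕ
ext ρ zero    = zero
ext ρ (suc n) = suc (ρ n)

rename : (ℕ → ℕ) → Term → Term
rename ρ (var x)   = var (ρ x)
rename ρ (lam t)   = lam (rename (ext ρ) t)
rename ρ (app t u) = app (rename ρ t) (rename ρ u)

exts : (ℕ → Term) → ℕ → Term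
exts σ zero    = var zero
exts σ (suc n) = rename suc (σ n)

subst : (ℕ → Term) → Term → Term
subst σ (var x)   = σ x
subst σ (lam t)   = lam (subst (exts σ) t)
subst σ (app t u) = app (subst σ t) (subst σ u)

-- the substitution [0 := N] (with the other free indices decremented)
single : Term → ℕ → Term
single N zero    = N
single N (suc n) = var n

-- M [ N ]  corresponds to  M[y := N]  where y is the bound variable of λy.M
_[_] : Term → Term → Term
M [ N ] = subst (single N) M

data _⟶β_ : Term → Term → Set where
  β    : ∀ {M N} → app (lam M) N ⟶β (M [ N ])
  ξlam : ∀ {M M'} → M ⟶β M' → lam M ⟶β lam M'
  ξl   : ∀ {M M' N} → M ⟶β M' → app M N ⟶β app M' N
  ξr   : ∀ {M N N'} → N ⟶β N' → app M N ⟶β app M N'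

_↠β_ : Term → Term → Set
_↠β_ = Star _⟶β_

-- Head reduction:  λx₁…xₙ.(λy.M)N N₁…Nₘ → λx₁…xₙ.M[y:=N]N₁…Nₘ

data HeadApp : Term → Term → Set where
  hβ   : ∀ {M N} → HeadApp (app (lam M) N) (M [ N ])
  happ : ∀ {M M' N} → HeadApp M M' → HeadApp (app M N) (app M' N)

data _⟶h_ : Term → Term → Set where
  hspine : ∀ {M M'} → HeadApp M M' → M ⟶h M'
  hlam   : ∀ {M M'} → M ⟶h M' → lam M ⟶h lam M'

data HeadSteps : ℕ → Term → Term → Set where
  done : ∀ {M} → HeadSteps zero M M
  step : ∀ {k M M' M''} → M ⟶h M' → HeadSteps k M' M'' → HeadSteps (suc k) M M''

data Neutral : Term → Set where
  nvar : ∀ {y} → Neutral (var y)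
  napp : ∀ {M N} → Neutral M → Neutral (app M N)

data IsHnf : Term → Set where
  hneu : ∀ {M} → Neutral M → IsHnf M
  hlam : ∀ {M} → IsHnf M → IsHnf (lam M)

HasHnf : Term → Set
HasHnf t = ∃ λ u → (t ↠β u) × IsHnf u

data Dir : Set where
  d0 d1 d2 : Dir   -- 0: body of abstraction, 1: function part, 2: argument part

Pos : Set
Pos = List Dir

data Label : Set where
  botL : Label
  lamL : Label
  appL : Label
  varL : ℕ → Label

-- The clocked Böhm tree, given as a relation:
--   CBTAt t p l a   :  position p exists in CBT(t), its node has label l
--                      and annotation a (nothing = unannotated).
--   SkelAt u p l a  :  same, for the tree  λx₁…xₙ. y CBT(M₁)…CBT(Mₘ)
--                      built from a hnf u, with its root left unannotated.

mutual
  data CBTAt : Term → Pos → Label → Maybe ℕ → Set where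
    atBot  : ∀ {t} → ¬ HasHnf t → CBTAt t [] botL nothing
    atRoot : ∀ {t u k l a} → HeadSteps k t u → IsHnf u →
             SkelAt u [] l a → CBTAt t [] l (just k)
    atSub  : ∀ {t u k d p l a} → HeadSteps k t u → IsHnf u →
             SkelAt u (d ∷ p) l a → CBTAt t (d ∷ p) l a

  data SkelAt : Term → Pos → Label → Maybe ℕ → Set where
    sLam     : ∀ {M} → SkelAt (lam M) [] lamL nothing
    sLamBody : ∀ {M p l a} → SkelAt M p l a → SkelAt (lam M) (d0 ∷ p) l a
    sVar     : ∀ {y} → SkelAt (var y) [] (varL y) nothing
    sApp     : ∀ {M N} → SkelAt (app M N) [] appL nothing
    sAppFun  : ∀ {M N p l a} → SkelAt M p l a → SkelAt (app M N) (d1 ∷ p) l a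
    sAppArg  : ∀ {M N p l a} → CBTAt N p l a → SkelAt (app M N) (d2 ∷ p) l a

BTAt : Term → Pos → Label → Set
BTAt t p l = ∃ λ a → CBTAt t p l a

AnnAt : Term → Pos → ℕ → Set
AnnAt t p k = ∃ λ l → CBTAt t p l (just k)

Annotated : Term → Pos → Set
Annotated t p = ∃ λ k → AnnAt t p k

-- We work with Tait–Martin-Löf parallel reduction _⇒_, since M ↠β N gives a
-- sequence of parallel steps M ⇒* N.  Two facts about head reduction drive
-- everything:
--   * clock acceleration: if M ⇒ N and M reaches a hnf u in k head steps,
--     then N reaches a hnf u' in k' ≤ k head steps and u ⇒* u'.  A parallel
--     step either commutes with a head step or already contracts its redex.
--   * standardisation: if M ⇒ N and N reaches a hnf by head reduction, so
--     does M.  Proved via Takahashi's decomposition of a parallel step into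
--     head steps followed by an internal parallel step.
-- With determinism of head reduction these show that having a hnf is
-- invariant under ⇒*, and that the head-step counts can only decrease.  A
-- parallel reduction between hnfs preserves their shape λx⃗.y M₁…Mₘ and
-- reduces the arguments, so induction on positions transfers every node of
-- CBT(M) to CBT(N) and back with the same label and a smaller-or-equal clock.
-- The theorem then follows, using that annotations are functional.
module Submission where

open import Defs
open import Data.Nat using (ℕ; zero; suc; _≤_; z≤n; s≤s)
open import Data.Nat.Properties using (≤-refl; ≤-trans; m≤n⇒m≤1+n)
open import Data.Maybe using (Maybe; just; nothing)
open import Data.Product using (Σ; _×_; _,_; proj₁)
open import Data.Sum using (_⊎_; inj₁; inj₂)
open import Data.Empty using (⊥; ⊥-elim)
open import Function using (_∘_; id)
open import Relation.Binary.PropositionalEquality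
  using (_≡_; _≗_; refl; sym; trans; cong; cong₂; subst₂)
open import Relation.Binary.Construct.Closure.ReflexiveTransitive
  using (Star; ε; _◅_; _◅◅_; gmap)
open import Function.Bundles using (_⇔_; mk⇔)

ext-cong : ∀ {ρ ρ' : ℕ → ℕ} → ρ ≗ ρ' → ext ρ ≗ ext ρ'
ext-cong h zero    = refl
ext-cong h (suc x) = cong suc (h x)

rename-cong : ∀ {ρ ρ' : ℕ → ℕ} → ρ ≗ ρ' → rename ρ ≗ rename ρ'
rename-cong h (var x)   = cong var (h x)
rename-cong h (lam M)   = cong lam (rename-cong (ext-cong h) M)
rename-cong h (app M N) = cong₂ app (rename-cong h M) (rename-cong h N)

exts-cong : ∀ {σ τ : ℕ → Term} → σ ≗ τ → exts σ ≗ exts τ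
exts-cong h zero    = refl
exts-cong h (suc x) = cong (rename suc) (h x)

subst-cong : ∀ {σ τ : ℕ → Term} → σ ≗ τ → subst σ ≗ subst τ
subst-cong h (var x)   = h x
subst-cong h (lam M)   = cong lam (subst-cong (exts-cong h) M)
subst-cong h (app M N) = cong₂ app (subst-cong h M) (subst-cong h N)

rename-rename : ∀ ρ ρ' M → rename ρ (rename ρ' M) ≡ rename (ρ ∘ ρ') M
rename-rename ρ ρ' (var x)   = refl
rename-rename ρ ρ' (lam M)   =
  cong lam (trans (rename-rename (ext ρ) (ext ρ') M) (rename-cong ext-∘ M))
  where
  ext-∘ : ext ρ ∘ ext ρ' ≗ ext (ρ ∘ ρ')
  ext-∘ zero    = refl
  ext-∘ (suc x) = refl
rename-rename ρ ρ' (app M N) = cong₂ app (rename-rename ρ ρ' M) (rename-rename ρ ρ' N)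

subst-rename : ∀ σ ρ M → subst σ (rename ρ M) ≡ subst (σ ∘ ρ) M
subst-rename σ ρ (var x)   = refl
subst-rename σ ρ (lam M)   =
  cong lam (trans (subst-rename (exts σ) (ext ρ) M) (subst-cong exts-∘-ext M))
  where
  exts-∘-ext : exts σ ∘ ext ρ ≗ exts (σ ∘ ρ)
  exts-∘-ext zero    = refl
  exts-∘-ext (suc x) = refl
subst-rename σ ρ (app M N) = cong₂ app (subst-rename σ ρ M) (subst-rename σ ρ N)

rename-subst : ∀ ρ σ M → rename ρ (subst σ M) ≡ subst (rename ρ ∘ σ) M
rename-subst ρ σ (var x)   = refl
rename-subst ρ σ (lam M)   =
  cong lam (trans (rename-subst (ext ρ) (exts σ) M) (subst-cong ext-∘-exts M))
  where
  ext-∘-exts : rename (ext ρ) ∘ exts σ ≗ exts (rename ρ ∘ σ)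
  ext-∘-exts zero    = refl
  ext-∘-exts (suc x) = trans (rename-rename (ext ρ) suc (σ x)) (sym (rename-rename suc ρ (σ x)))
rename-subst ρ σ (app M N) = cong₂ app (rename-subst ρ σ M) (rename-subst ρ σ N)

subst-subst : ∀ σ τ M → subst σ (subst τ M) ≡ subst (subst σ ∘ τ) M
subst-subst σ τ (var x)   = refl
subst-subst σ τ (lam M)   =
  cong lam (trans (subst-subst (exts σ) (exts τ) M) (subst-cong exts-∘-exts M))
  where
  exts-∘-exts : subst (exts σ) ∘ exts τ ≗ exts (subst σ ∘ τ)
  exts-∘-exts zero    = refl
  exts-∘-exts (suc x) = trans (subst-rename (exts σ) suc (τ x)) (sym (rename-subst suc σ (τ x)))
subst-subst σ τ (app M N) = cong₂ app (subst-subst σ τ M) (subst-subst σ τ N)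

subst-id : ∀ M → subst var M ≡ M
subst-id (var x)   = refl
subst-id (lam M)   = cong lam (trans (subst-cong exts-var M) (subst-id M))
  where
  exts-var : exts var ≗ var
  exts-var zero    = refl
  exts-var (suc x) = refl
subst-id (app M N) = cong₂ app (subst-id M) (subst-id N)

subst-[] : ∀ σ A B → subst σ (A [ B ]) ≡ subst (exts σ) A [ subst σ B ]
subst-[] σ A B =
  trans (subst-subst σ (single B) A)
        (sym (trans (subst-subst (single (subst σ B)) (exts σ) A) (subst-cong single-exts A)))
  where
  single-exts : subst (single (subst σ B)) ∘ exts σ ≗ subst σ ∘ single B
  single-exts zero    = refl
  single-exts (suc x) = trans (subst-rename (single (subst σ B)) suc (σ x)) (subst-id (σ x))

rename-[] : ∀ ρ A B → rename ρ (A [ B ]) ≡ rename (ext ρ) A [ rename ρ B ]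
rename-[] ρ A B =
  trans (rename-subst ρ (single B) A)
        (sym (trans (subst-rename (single (rename ρ B)) (ext ρ) A) (subst-cong single-ext A)))
  where
  single-ext : single (rename ρ B) ∘ ext ρ ≗ rename ρ ∘ single B
  single-ext zero    = refl
  single-ext (suc x) = refl

infix 4 _⇒_ _⇒*_ _⇒ᵢ_

data _⇒_ : Term → Term → Set where
  pvar : ∀ {x} → var x ⇒ var x
  plam : ∀ {M M'} → M ⇒ M' → lam M ⇒ lam M'
  papp : ∀ {M M' N N'} → M ⇒ M' → N ⇒ N' → app M N ⇒ app M' N'
  pβ   : ∀ {M M' N N'} → M ⇒ M' → N ⇒ N' → app (lam M) N ⇒ M' [ N' ]

_⇒*_ : Term → Term → Set
_⇒*_ = Star _⇒_

par-refl : ∀ M → M ⇒ M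
par-refl (var x)   = pvar
par-refl (lam M)   = plam (par-refl M)
par-refl (app M N) = papp (par-refl M) (par-refl N)

β⊆par : ∀ {M N} → M ⟶β N → M ⇒ N
β⊆par (β {M} {N})      = pβ (par-refl M) (par-refl N)
β⊆par (ξlam s)         = plam (β⊆par s)
β⊆par (ξl {N = N} s)   = papp (β⊆par s) (par-refl N)
β⊆par (ξr {M = M} s)   = papp (par-refl M) (β⊆par s)

↠β⊆par* : ∀ {M N} → M ↠β N → M ⇒* N
↠β⊆par* = gmap id β⊆par

par-rename : ∀ ρ {M N} → M ⇒ N → rename ρ M ⇒ rename ρ N
par-rename ρ pvar       = pvar
par-rename ρ (plam p)   = plam (par-rename (ext ρ) p)
par-rename ρ (papp p q) = papp (par-rename ρ p) (par-rename ρ q)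
par-rename ρ (pβ {M' = M'} {N' = N'} p q) =
  subst₂ _⇒_ refl (sym (rename-[] ρ M' N')) (pβ (par-rename (ext ρ) p) (par-rename ρ q))

par-exts : ∀ {σ τ} → (∀ x → σ x ⇒ τ x) → ∀ x → exts σ x ⇒ exts τ x
par-exts h zero    = pvar
par-exts h (suc x) = par-rename suc (h x)

par-subst : ∀ {σ τ} → (∀ x → σ x ⇒ τ x) → ∀ {M N} → M ⇒ N → subst σ M ⇒ subst τ N
par-subst h (pvar {x})  = h x
par-subst h (plam p)    = plam (par-subst (par-exts h) p)
par-subst h (papp p q)  = papp (par-subst h p) (par-subst h q)
par-subst {τ = τ} h (pβ {M' = M'} {N' = N'} p q) =
  subst₂ _⇒_ refl (sym (subst-[] τ M' N')) (pβ (par-subst (par-exts h) p) (par-subst h q))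

par-single : ∀ {N N'} → N ⇒ N' → ∀ x → single N x ⇒ single N' x
par-single q zero    = q
par-single q (suc x) = pvar

par-[] : ∀ {M M' N N'} → M ⇒ M' → N ⇒ N' → M [ N ] ⇒ M' [ N' ]
par-[] p q = par-subst (par-single q) p

par-neutral : ∀ {M N} → M ⇒ N → Neutral M → Neutral N
par-neutral pvar       nvar     = nvar
par-neutral (papp p q) (napp n) = napp (par-neutral p n)
par-neutral (pβ p q)   (napp ())

par-hnf : ∀ {M N} → M ⇒ N → IsHnf M → IsHnf N
par-hnf p        (hneu n) = hneu (par-neutral p n)
par-hnf (plam p) (hlam h) = hlam (par-hnf p h)

var-par* : ∀ {x X} → var x ⇒* X → X ≡ var x
var-par* ε            = refl
var-par* (pvar ◅ ps)  = var-par* ps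

lam-par* : ∀ {M X} → lam M ⇒* X → Σ Term λ M' → X ≡ lam M' × M ⇒* M'
lam-par* ε = _ , refl , ε
lam-par* (plam p ◅ ps) with lam-par* ps
... | M' , refl , qs = M' , refl , p ◅ qs

neutral-app-par* : ∀ {M N X} → Neutral M → app M N ⇒* X →
                   Σ Term λ M' → Σ Term λ N' → X ≡ app M' N' × M ⇒* M' × N ⇒* N'
neutral-app-par* n ε = _ , _ , refl , ε , ε
neutral-app-par* n (papp p q ◅ ps) with neutral-app-par* (par-neutral p n) ps
... | M' , N' , refl , rm , rn = M' , N' , refl , p ◅ rm , q ◅ rn
neutral-app-par* () (pβ p q ◅ ps)

spine⊆β : ∀ {M N} → HeadApp M N → M ⟶β N
spine⊆β hβ       = β
spine⊆β (happ h) = ξl (spine⊆β h)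

head⊆β : ∀ {M N} → M ⟶h N → M ⟶β N
head⊆β (hspine h) = spine⊆β h
head⊆β (hlam s)   = ξlam (head⊆β s)

head-steps⊆↠β : ∀ {k M u} → HeadSteps k M u → M ↠β u
head-steps⊆↠β done        = ε
head-steps⊆↠β (step s ss) = head⊆β s ◅ head-steps⊆↠β ss

neutral-no-spine-step : ∀ {M M'} → Neutral M → HeadApp M M' → ⊥
neutral-no-spine-step (napp ()) hβ
neutral-no-spine-step (napp n)  (happ h) = neutral-no-spine-step n h

hnf-no-head-step : ∀ {M M'} → IsHnf M → M ⟶h M' → ⊥
hnf-no-head-step (hneu n)   (hspine h) = neutral-no-spine-step n h
hnf-no-head-step (hneu ())  (hlam s)
hnf-no-head-step (hlam h)   (hspine ())
hnf-no-head-step (hlam h)   (hlam s)   = hnf-no-head-step h s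

spine-det : ∀ {M M₁ M₂} → HeadApp M M₁ → HeadApp M M₂ → M₁ ≡ M₂
spine-det hβ       hβ       = refl
spine-det hβ       (happ ())
spine-det (happ ()) hβ
spine-det (happ a) (happ b) = cong (λ X → app X _) (spine-det a b)

head-det : ∀ {M M₁ M₂} → M ⟶h M₁ → M ⟶h M₂ → M₁ ≡ M₂
head-det (hspine a) (hspine b) = spine-det a b
head-det (hspine ()) (hlam _)
head-det (hlam _)   (hspine ())
head-det (hlam a)   (hlam b)   = cong lam (head-det a b)

head-normal-form-unique : ∀ {k k' M u u'} → HeadSteps k M u → IsHnf u →
                          HeadSteps k' M u' → IsHnf u' → k ≡ k' × u ≡ u'
head-normal-form-unique done        hu done          hu' = refl , refl
head-normal-form-unique done        hu (step s _)    _   = ⊥-elim (hnf-no-head-step hu s)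
head-normal-form-unique (step s _)  _  done          hu' = ⊥-elim (hnf-no-head-step hu' s)
head-normal-form-unique (step s ss) hu (step s' ss') hu' with head-det s s'
... | refl with head-normal-form-unique ss hu ss' hu'
... | refl , refl = refl , refl

HeadNormalising : Term → Set
HeadNormalising M = Σ ℕ λ k → Σ Term λ u → HeadSteps k M u × IsHnf u

head-normalising⇒hasHnf : ∀ {M} → HeadNormalising M → HasHnf M
head-normalising⇒hasHnf (k , u , st , hu) = u , head-steps⊆↠β st , hu

lam-head-steps : ∀ {k M u} → HeadSteps k M u → HeadSteps k (lam M) (lam u)
lam-head-steps done        = done
lam-head-steps (step s ss) = step (hlam s) (lam-head-steps ss)

unlam-head-steps : ∀ {k N u} → HeadSteps k (lam N) u → IsHnf u →
                   Σ Term λ u₀ → HeadSteps k N u₀ × IsHnf u₀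
unlam-head-steps done               (hlam h)  = _ , done , h
unlam-head-steps done               (hneu ())
unlam-head-steps (step (hspine ()) ss) hu
unlam-head-steps (step (hlam s) ss) hu with unlam-head-steps ss hu
... | u₀ , ss' , h = u₀ , step s ss' , h

spine-steps-head-normalising : ∀ {M L} → Star HeadApp M L → HeadNormalising L → HeadNormalising M
spine-steps-head-normalising ε        h = h
spine-steps-head-normalising (s ◅ ss) h with spine-steps-head-normalising ss h
... | k , u , st , hu = suc k , u , step (hspine s) st , hu

par-spine-step : ∀ {M N M'} → M ⇒ N → HeadApp M M' →
                 (Σ Term λ N' → HeadApp N N' × M' ⇒ N') ⊎ (M' ⇒ N)
par-spine-step (papp (plam p) q) hβ       = inj₁ (_ , hβ , par-[] p q)
par-spine-step (pβ p q)          hβ       = inj₂ (par-[] p q)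
par-spine-step (pβ p q)          (happ ())
par-spine-step (papp p q)        (happ h) with par-spine-step p h
... | inj₁ (N' , h' , r) = inj₁ (_ , happ h' , papp r q)
... | inj₂ r             = inj₂ (papp r q)

par-head-step : ∀ {M N M'} → M ⇒ N → M ⟶h M' →
                (Σ Term λ N' → N ⟶h N' × M' ⇒ N') ⊎ (M' ⇒ N)
par-head-step p (hspine h) with par-spine-step p h
... | inj₁ (N' , h' , r) = inj₁ (N' , hspine h' , r)
... | inj₂ r             = inj₂ r
par-head-step (plam p) (hlam s) with par-head-step p s
... | inj₁ (N' , s' , r) = inj₁ (lam N' , hlam s' , plam r)
... | inj₂ r             = inj₂ (plam r)

Accelerated : ℕ → Term → Term → Set
Accelerated k N u = Σ ℕ λ k' → k' ≤ k × Σ Term λ u' → HeadSteps k' N u' × IsHnf u' × u ⇒* u'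

par-accelerates : ∀ {k M N u} → M ⇒ N → HeadSteps k M u → IsHnf u → Accelerated k N u
par-accelerates p done hu = 0 , z≤n , _ , done , par-hnf p hu , p ◅ ε
par-accelerates p (step s ss) hu with par-head-step p s
... | inj₁ (N' , s' , r) with par-accelerates r ss hu
...   | k' , k'≤k , u' , ss' , hu' , r' = suc k' , s≤s k'≤k , u' , step s' ss' , hu' , r'
par-accelerates p (step s ss) hu | inj₂ r with par-accelerates r ss hu
...   | k' , k'≤k , u' , ss' , hu' , r' = k' , m≤n⇒m≤1+n k'≤k , u' , ss' , hu' , r'

par*-accelerates : ∀ {k M N u} → M ⇒* N → HeadSteps k M u → IsHnf u → Accelerated k N u
par*-accelerates ε st hu = _ , ≤-refl , _ , st , hu , ε
par*-accelerates (p ◅ ps) st hu with par-accelerates p st hu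
... | k₁ , k₁≤k , u₁ , st₁ , hu₁ , r₁ with par*-accelerates ps st₁ hu₁
... | k₂ , k₂≤k₁ , u₂ , st₂ , hu₂ , r₂ = k₂ , ≤-trans k₂≤k₁ k₁≤k , u₂ , st₂ , hu₂ , r₁ ◅◅ r₂

-- Internal parallel reduction contracts no redex on the head spine.
data _⇒ᵢ_ : Term → Term → Set where
  ivar : ∀ {x} → var x ⇒ᵢ var x
  ilam : ∀ {M M'} → M ⇒ M' → lam M ⇒ᵢ lam M'
  iapp : ∀ {M M' N N'} → M ⇒ᵢ M' → N ⇒ N' → app M N ⇒ᵢ app M' N'

_⇛_ : Term → Term → Set
M ⇛ N = Σ Term λ L → Star HeadApp M L × L ⇒ᵢ N

spine-steps-app : ∀ {M M'} N → Star HeadApp M M' → Star HeadApp (app M N) (app M' N)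
spine-steps-app N = gmap (λ M → app M N) happ

spine-steps-subst : ∀ σ {M M'} → Star HeadApp M M' → Star HeadApp (subst σ M) (subst σ M')
spine-steps-subst σ = gmap (subst σ) spine-subst
  where
  spine-subst : ∀ {M M'} → HeadApp M M' → HeadApp (subst σ M) (subst σ M')
  spine-subst (hβ {M} {N}) = subst₂ HeadApp refl (sym (subst-[] σ M N)) hβ
  spine-subst (happ h)     = happ (spine-subst h)

internal-subst : ∀ {σ τ} → (∀ x → σ x ⇛ τ x) → (∀ x → σ x ⇒ τ x) →
                 ∀ {L A} → L ⇒ᵢ A → subst σ L ⇛ subst τ A
internal-subst hh h (ivar {x}) = hh x
internal-subst {σ} hh h (ilam {M} p) = lam (subst (exts σ) M) , ε , ilam (par-subst (par-exts h) p)
internal-subst {σ} hh h (iapp {N = N} w q) with internal-subst hh h w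
... | K , s , w' = app K (subst σ N) , spine-steps-app (subst σ N) s , iapp w' (par-subst h q)

par-decompose : ∀ {M N} → M ⇒ N → M ⇛ N
par-decompose (pvar {x})       = var x , ε , ivar
par-decompose (plam {M} p)     = lam M , ε , ilam p
par-decompose (papp {N = N} p q) with par-decompose p
... | L , s , w = app L N , spine-steps-app N s , iapp w q
par-decompose (pβ {N = N} {N' = N'} p q) with par-decompose p
... | L , s , w with internal-subst single-decompose (par-single q) w
  where
  single-decompose : ∀ x → single N x ⇛ single N' x
  single-decompose zero    = par-decompose q
  single-decompose (suc x) = var x , ε , ivar
... | K , s' , w' = K , hβ ◅ (spine-steps-subst (single N) s ◅◅ s') , w'

internal-spine-swap : ∀ {L N N₁} → L ⇒ᵢ N → HeadApp N N₁ → Σ Term λ L₁ → HeadApp L L₁ × L₁ ⇒ N₁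
internal-spine-swap (iapp (ilam p) q) hβ = _ , hβ , par-[] p q
internal-spine-swap (iapp w q) (happ h) with internal-spine-swap w h
... | L₁ , h' , r = _ , happ h' , papp r q

internal-neutral : ∀ {L N} → L ⇒ᵢ N → Neutral N → Neutral L
internal-neutral ivar       nvar     = nvar
internal-neutral (iapp w q) (napp n) = napp (internal-neutral w n)

mutual
  -- If M ⇒ N and N head-normalises in k steps then M head-normalises;
  -- by induction on k and, for abstractions, on N.
  par-reflects-hn : ∀ (k : ℕ) (N : Term) {M u} → M ⇒ N → HeadSteps k N u → IsHnf u →
                    HeadNormalising M
  par-reflects-hn k N p st hu with par-decompose p
  ... | L , s , w = spine-steps-head-normalising s (internal-reflects-hn k N w st hu)

  internal-reflects-hn : ∀ (k : ℕ) (N : Term) {L u} → L ⇒ᵢ N → HeadSteps k N u → IsHnf u →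
                         HeadNormalising L
  internal-reflects-hn k (lam N₀) (ilam p) st hu with unlam-head-steps st hu
  ... | u₀ , st₀ , hu₀ with par-reflects-hn k N₀ p st₀ hu₀
  ... | k' , v , st' , hv = k' , lam v , lam-head-steps st' , hlam hv
  internal-reflects-hn .zero (var x) ivar done hu = 0 , var x , done , hneu nvar
  internal-reflects-hn .(suc _) (var x) ivar (step (hspine ()) ss) hu
  internal-reflects-hn .zero (app N C) w@(iapp _ _) done (hneu n) =
    0 , _ , done , hneu (internal-neutral w n)
  internal-reflects-hn (suc k) (app N C) w@(iapp _ _) (step (hspine h) ss) hu
    with internal-spine-swap w h
  ... | L₁ , h' , r with par-reflects-hn k _ r ss hu
  ... | k' , v , st' , hv = suc k' , v , step (hspine h') st' , hv

par*-reflects-hn : ∀ {M N} → M ⇒* N → HeadNormalising N → HeadNormalising M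
par*-reflects-hn ε        h = h
par*-reflects-hn (p ◅ ps) h with par*-reflects-hn ps h
... | k , u , st , hu = par-reflects-hn k _ p st hu

hasHnf⇒head-normalising : ∀ {M} → HasHnf M → HeadNormalising M
hasHnf⇒head-normalising (u , r , hu) = par*-reflects-hn (↠β⊆par* r) (0 , u , done , hu)

hasHnf-forward : ∀ {M N} → M ⇒* N → HasHnf M → HasHnf N
hasHnf-forward r h with hasHnf⇒head-normalising h
... | k , u , st , hu with par*-accelerates r st hu
... | k' , _ , u' , st' , hu' , _ = head-normalising⇒hasHnf (k' , u' , st' , hu')

hasHnf-backward : ∀ {M N} → M ⇒* N → HasHnf N → HasHnf M
hasHnf-backward r h = head-normalising⇒hasHnf (par*-reflects-hn r (hasHnf⇒head-normalising h))

clock-comparison : ∀ {k k' M N u u'} → M ⇒* N → HeadSteps k M u → IsHnf u →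
                   HeadSteps k' N u' → IsHnf u' → k' ≤ k × u ⇒* u'
clock-comparison r st hu st' hu' with par*-accelerates r st hu
... | k'' , k''≤k , u'' , st'' , hu'' , ru with head-normal-form-unique st'' hu'' st' hu'
... | refl , refl = k''≤k , ru

data _⊒_ : Maybe ℕ → Maybe ℕ → Set where
  unannotated : nothing ⊒ nothing
  annotated   : ∀ {k k'} → k' ≤ k → just k ⊒ just k'

mutual
  skel-forward : ∀ {u u' p l a} → IsHnf u → u ⇒* u' → SkelAt u p l a →
                 Σ (Maybe ℕ) λ a' → SkelAt u' p l a' × a ⊒ a'
  skel-forward hu r sLam with lam-par* r
  ... | _ , refl , _ = nothing , sLam , unannotated
  skel-forward (hlam hu) r (sLamBody s) with lam-par* r
  ... | _ , refl , rs with skel-forward hu rs s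
  ... | a' , s' , a⊒a' = a' , sLamBody s' , a⊒a'
  skel-forward (hneu ()) r (sLamBody s)
  skel-forward hu r sVar with var-par* r
  ... | refl = nothing , sVar , unannotated
  skel-forward (hneu (napp n)) r sApp with neutral-app-par* n r
  ... | _ , _ , refl , _ , _ = nothing , sApp , unannotated
  skel-forward (hneu (napp n)) r (sAppFun s) with neutral-app-par* n r
  ... | _ , _ , refl , rm , _ with skel-forward (hneu n) rm s
  ... | a' , s' , a⊒a' = a' , sAppFun s' , a⊒a'
  skel-forward (hneu (napp n)) r (sAppArg c) with neutral-app-par* n r
  ... | _ , _ , refl , _ , rn with cbt-forward rn c
  ... | a' , c' , a⊒a' = a' , sAppArg c' , a⊒a'

  cbt-forward : ∀ {t t' p l a} → t ⇒* t' → CBTAt t p l a →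
                Σ (Maybe ℕ) λ a' → CBTAt t' p l a' × a ⊒ a'
  cbt-forward r (atBot nh) = nothing , atBot (nh ∘ hasHnf-backward r) , unannotated
  cbt-forward r (atRoot st hu s) with par*-accelerates r st hu
  ... | k' , k'≤k , u' , st' , hu' , ru with skel-forward hu ru s
  ... | a' , s' , _ = just k' , atRoot st' hu' s' , annotated k'≤k
  cbt-forward r (atSub st hu s) with par*-accelerates r st hu
  ... | k' , k'≤k , u' , st' , hu' , ru with skel-forward hu ru s
  ... | a' , s' , a⊒a' = a' , atSub st' hu' s' , a⊒a'

mutual
  skel-backward : ∀ {u u' p l a'} → IsHnf u → u ⇒* u' → SkelAt u' p l a' →
                  Σ (Maybe ℕ) λ a → SkelAt u p l a × a ⊒ a'
  skel-backward (hlam hu) r s with lam-par* r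
  skel-backward (hlam hu) r sLam         | _ , refl , rs = nothing , sLam , unannotated
  skel-backward (hlam hu) r (sLamBody s) | _ , refl , rs with skel-backward hu rs s
  ... | a , s' , a⊒a' = a , sLamBody s' , a⊒a'
  skel-backward (hneu nvar) r s with var-par* r
  skel-backward (hneu nvar) r sVar | refl = nothing , sVar , unannotated
  skel-backward (hneu (napp n)) r s with neutral-app-par* n r
  skel-backward (hneu (napp n)) r sApp        | _ , _ , refl , _ , _ = nothing , sApp , unannotated
  skel-backward (hneu (napp n)) r (sAppFun s) | _ , _ , refl , rm , _ with skel-backward (hneu n) rm s
  ... | a , s' , a⊒a' = a , sAppFun s' , a⊒a'
  skel-backward (hneu (napp n)) r (sAppArg c) | _ , _ , refl , _ , rn with cbt-backward rn c
  ... | a , c' , a⊒a' = a , sAppArg c' , a⊒a'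

  cbt-backward : ∀ {t t' p l a'} → t ⇒* t' → CBTAt t' p l a' →
                 Σ (Maybe ℕ) λ a → CBTAt t p l a × a ⊒ a'
  cbt-backward r (atBot nh) = nothing , atBot (nh ∘ hasHnf-forward r) , unannotated
  cbt-backward r (atRoot st' hu' s') with par*-reflects-hn r (_ , _ , st' , hu')
  ... | k , u , st , hu with clock-comparison r st hu st' hu'
  ... | k'≤k , ru with skel-backward hu ru s'
  ... | _ , s , _ = just k , atRoot st hu s , annotated k'≤k
  cbt-backward r (atSub st' hu' s') with par*-reflects-hn r (_ , _ , st' , hu')
  ... | k , u , st , hu with clock-comparison r st hu st' hu'
  ... | _ , ru with skel-backward hu ru s'
  ... | a , s , a⊒a' = a , atSub st hu s , a⊒a'

mutual
  cbt-annotation-unique : ∀ {t p l l' a a'} → CBTAt t p l a → CBTAt t p l' a' → a ≡ a'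
  cbt-annotation-unique (atBot _)        (atBot _)         = refl
  cbt-annotation-unique (atBot nh)       (atRoot st hu _)  =
    ⊥-elim (nh (head-normalising⇒hasHnf (_ , _ , st , hu)))
  cbt-annotation-unique (atRoot st hu _) (atBot nh)        =
    ⊥-elim (nh (head-normalising⇒hasHnf (_ , _ , st , hu)))
  cbt-annotation-unique (atRoot st hu _) (atRoot st' hu' _) =
    cong just (proj₁ (head-normal-form-unique st hu st' hu'))
  cbt-annotation-unique (atSub st hu s)  (atSub st' hu' s') with head-normal-form-unique st hu st' hu'
  ... | refl , refl = skel-annotation-unique s s'

  skel-annotation-unique : ∀ {u p l l' a a'} → SkelAt u p l a → SkelAt u p l' a' → a ≡ a'
  skel-annotation-unique sLam         sLam          = refl
  skel-annotation-unique (sLamBody s) (sLamBody s') = skel-annotation-unique s s'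
  skel-annotation-unique sVar         sVar          = refl
  skel-annotation-unique sApp         sApp          = refl
  skel-annotation-unique (sAppFun s)  (sAppFun s')  = skel-annotation-unique s s'
  skel-annotation-unique (sAppArg c)  (sAppArg c')  = cbt-annotation-unique c c'

bt-invariant : ∀ {t t'} → t ⇒* t' → ∀ p l → BTAt t p l ⇔ BTAt t' p l
bt-invariant r p l = mk⇔ forward backward
  where
  forward : BTAt _ p l → BTAt _ p l
  forward (_ , c) with cbt-forward r c
  ... | a' , c' , _ = a' , c'
  backward : BTAt _ p l → BTAt _ p l
  backward (_ , c') with cbt-backward r c'
  ... | a , c , _ = a , c

annotated-invariant : ∀ {t t'} → t ⇒* t' → ∀ p → Annotated t p ⇔ Annotated t' p
annotated-invariant r p = mk⇔ forward backward
  where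
  forward : Annotated _ p → Annotated _ p
  forward (_ , l , c) with cbt-forward r c
  ... | just k' , c' , annotated _ = k' , l , c'
  backward : Annotated _ p → Annotated _ p
  backward (_ , l , c') with cbt-backward r c'
  ... | just k , c , annotated _ = k , l , c

clock-decreases : ∀ {t t' p k k'} → t ⇒* t' → AnnAt t p k → AnnAt t' p k' → k' ≤ k
clock-decreases r (l , c) (l' , c') with cbt-forward r c
... | just k'' , c'' , annotated k''≤k with cbt-annotation-unique c'' c'
... | refl = k''≤k

proposition21 : ∀ (M N : Term) → M ↠β N →
    (∀ (p : Pos) (l : Label) → BTAt M p l ⇔ BTAt N p l) ×
    (∀ (p : Pos) → (Annotated M p ⇔ Annotated N p) ×
                   (∀ (k k' : ℕ) → AnnAt M p k → AnnAt N p k' → k' ≤ k))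
proposition21 M N r =
  bt-invariant M⇒*N ,
  λ p → annotated-invariant M⇒*N p , λ k k' → clock-decreases M⇒*N
  where
  M⇒*N : M ⇒* N
  M⇒*N = ↠β⊆par* r
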